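{- Let $k\in\{1,2,3,4\}$, $G=\{(A_1,X_1),\dots,(A_n,X_n)\}$ and $(B,Y)$ I/O pairs. Then $G\vdash_{OUT_k}(B,Y)$ iff the classical propositional formula $\mathcal{F}^k_n\vee\big(\neg Y\wedge\bigwedge_{i=1}^nX_i\big)$ is unsatisfiable, where $\mathcal{F}^k_n=\neg T^k_n(B,Y)\wedge\bigwedge_{(A,X)\in G}T^k_n(A,X)$, with $N=1$ for $k\in\{2,4\}$ and $N=n+1$ for $k\in\{1,3\}$, $T^k_n(A,X)=\big(\bigwedge_{l=1}^{N}A^l\big)\to X^0$ for $k\in\{1,2\}$ and $T^k_n(A,X)=\big(\bigwedge_{l=1}^{N}A^l\big)\to\big(\bigwedge_{l=0}^{N}X^l\big)$ for $k\in\{3,4\}$.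
   Context: Formulas are classical propositional formulas built with $\top,\bot,\neg,\wedge,\vee,\to$; $\models$ denotes classical semantic entailment. An I/O pair is an ordered pair $(A,X)$ of formulas. Rules on pairs: (TOP) $(\top,\top)$ from no premises; (WO) from $(A,X)$ derive $(A,Y)$ whenever $X\models Y$; (SI) from $(A,X)$ derive $(B,X)$ whenever $B\models A$; (AND) from $(A,X_1)$ and $(A,X_2)$ derive $(A,X_1\wedge X_2)$; (OR) from $(A_1,X)$ and $(A_2,X)$ derive $(A_1\vee A_2,X)$; (CT) from $(A,X)$ and $(A\wedge X,Y)$ derive $(A,Y)$. $OUT_1$ = {TOP, WO, SI, AND}; $OUT_2$ = $OUT_1$ + OR; $OUT_3$ = $OUT_1$ + CT; $OUT_4$ = $OUT_1$ + OR + CT. $G\vdash_{L}(B,Y)$ means there is a finite tree with root $(B,Y)$, each leaf an element of $G$ or an axiom of $L$, and each non-leaf node obtained from its children by a rule of $L$. Let $\mathcal{V}$ be the set of propositional variables occurring in $G$ or $(B,Y)$. For each $x\in\mathcal{V}$ and $l\in\{0,\dots,N\}$ let $x^l$ be a fresh distinct variable; for a formula $A$ over $\mathcal{V}$, $A^l$ is obtained by replacing every variable $x$ by $x^l$. -}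

module Defs where

open import Data.Nat using (ℕ; zero; suc)
open import Data.Bool using (Bool; true; false; not; _∧_; _∨_)
open import Data.Fin using (Fin)
open import Data.Vec using (Vec; lookup; toList)
open import Data.List using (List; []; _∷_; map; foldr; upTo)
open import Data.Product using (_×_; _,_; proj₁; proj₂)
open import Data.Sum using (_⊎_; inj₁; inj₂)
open import Relation.Binary.PropositionalEquality using (_≡_)

data Formula (V : Set) : Set where
  var  : V → Formula V
  ⊤ᶠ   : Formula V
  ⊥ᶠ   : Formula V
  ¬ᶠ_  : Formula V → Formula V
  _∧ᶠ_ : Formula V → Formula V → Formula V
  _∨ᶠ_ : Formula V → Formula V → Formula V
  _⇒ᶠ_ : Formula V → Formula V → Formula V

infix  30 ¬ᶠ_
infixr 25 _∧ᶠ_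
infixr 24 _∨ᶠ_
infixr 23 _⇒ᶠ_

⟦_⟧ : {V : Set} → Formula V → (V → Bool) → Bool
⟦ var x ⟧   v = v x
⟦ ⊤ᶠ ⟧      v = true
⟦ ⊥ᶠ ⟧      v = false
⟦ ¬ᶠ A ⟧    v = not (⟦ A ⟧ v)
⟦ A ∧ᶠ B ⟧  v = ⟦ A ⟧ v ∧ ⟦ B ⟧ v
⟦ A ∨ᶠ B ⟧  v = ⟦ A ⟧ v ∨ ⟦ B ⟧ v
⟦ A ⇒ᶠ B ⟧  v = not (⟦ A ⟧ v) ∨ ⟦ B ⟧ v

_⊨_ : {V : Set} → Formula V → Formula V → Set
A ⊨ B = ∀ v → ⟦ A ⟧ v ≡ true → ⟦ B ⟧ v ≡ true

Unsat : {V : Set} → Formula V → Set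
Unsat A = ∀ v → ⟦ A ⟧ v ≡ false

rename : {V W : Set} → (V → W) → Formula V → Formula W
rename f (var x)   = var (f x)
rename f ⊤ᶠ        = ⊤ᶠ
rename f ⊥ᶠ        = ⊥ᶠ
rename f (¬ᶠ A)    = ¬ᶠ rename f A
rename f (A ∧ᶠ B)  = rename f A ∧ᶠ rename f B
rename f (A ∨ᶠ B)  = rename f A ∨ᶠ rename f B
rename f (A ⇒ᶠ B)  = rename f A ⇒ᶠ rename f B

⋀ : {V : Set} → List (Formula V) → Formula V
⋀ = foldr _∧ᶠ_ ⊤ᶠ

Fm : Set
Fm = Formula ℕ

IOPair : Set
IOPair = Fm × Fm

data OutK : Set where
  out₁ out₂ out₃ out₄ : OutK

data HasOR : OutK → Set where
  or₂ : HasOR out₂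
  or₄ : HasOR out₄

data HasCT : OutK → Set where
  ct₃ : HasCT out₃
  ct₄ : HasCT out₄

data _⊢[_]_ {n : ℕ} (G : Vec IOPair n) (k : OutK) : IOPair → Set where
  leaf : (i : Fin n) → G ⊢[ k ] lookup G i
  TOP  : G ⊢[ k ] (⊤ᶠ , ⊤ᶠ)
  WO   : ∀ {A X Y} → G ⊢[ k ] (A , X) → X ⊨ Y → G ⊢[ k ] (A , Y)
  SI   : ∀ {A B X} → G ⊢[ k ] (A , X) → B ⊨ A → G ⊢[ k ] (B , X)
  AND  : ∀ {A X₁ X₂} → G ⊢[ k ] (A , X₁) → G ⊢[ k ] (A , X₂) →
         G ⊢[ k ] (A , X₁ ∧ᶠ X₂)
  OR   : ∀ {A₁ A₂ X} → HasOR k → G ⊢[ k ] (A₁ , X) → G ⊢[ k ] (A₂ , X) →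
         G ⊢[ k ] (A₁ ∨ᶠ A₂ , X)
  CT   : ∀ {A X Y} → HasCT k → G ⊢[ k ] (A , X) → G ⊢[ k ] (A ∧ᶠ X , Y) →
         G ⊢[ k ] (A , Y)

-- Variables of the target formula: inj₁ x is the original variable x,
-- inj₂ (x , l) is the fresh copy x^l.
TVar : Set
TVar = ℕ ⊎ (ℕ × ℕ)

TFm : Set
TFm = Formula TVar

orig : Fm → TFm
orig = rename inj₁

copy : ℕ → Fm → TFm
copy l = rename (λ x → inj₂ (x , l))

Nk : OutK → ℕ → ℕ
Nk out₁ n = suc n
Nk out₂ n = 1
Nk out₃ n = suc n
Nk out₄ n = 1

from1 : ℕ → List ℕ
from1 N = map suc (upTo N)

from0 : ℕ → List ℕ
from0 N = upTo (suc N)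

T : OutK → ℕ → IOPair → TFm
T out₁ n (A , X) = ⋀ (map (λ l → copy l A) (from1 (Nk out₁ n))) ⇒ᶠ copy 0 X
T out₂ n (A , X) = ⋀ (map (λ l → copy l A) (from1 (Nk out₂ n))) ⇒ᶠ copy 0 X
T out₃ n (A , X) = ⋀ (map (λ l → copy l A) (from1 (Nk out₃ n))) ⇒ᶠ
                   ⋀ (map (λ l → copy l X) (from0 (Nk out₃ n)))
T out₄ n (A , X) = ⋀ (map (λ l → copy l A) (from1 (Nk out₄ n))) ⇒ᶠ
                   ⋀ (map (λ l → copy l X) (from0 (Nk out₄ n)))

𝓕 : (k : OutK) → {n : ℕ} → Vec IOPair n → IOPair → TFm
𝓕 k {n} G BY = ¬ᶠ T k n BY ∧ᶠ ⋀ (map (T k n) (toList G))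

Φ : (k : OutK) → {n : ℕ} → Vec IOPair n → IOPair → TFm
Φ k G (B , Y) = 𝓕 k G (B , Y) ∨ᶠ (¬ᶠ orig Y ∧ᶠ ⋀ (map (λ p → orig (proj₂ p)) (toList G)))

module Submission where

-- Read at a valuation w of the copied variables, T^k_n(A,X) says: if A holds at the layers
-- 1..N of w then X holds at layer 0, and with CT also at layers 1..N (Holds).  Every rule
-- preserves this for all w, and the output of a derivable pair is entailed by the outputs
-- of G; these two facts are exactly the unsatisfiability of the two disjuncts of Φ.
--
-- Conversely, for an antecedent C ⊨ B derive (C, ⋀ of the Xᵢ with C ⊨ Aᵢ) and show that it
-- entails Y: a valuation v of these outputs, stacked on layers that are models of C
-- refuting every other Aᵢ, makes 𝓕 true unless Y holds at v.  With N = n + 1 (OUT₁, OUT₃)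
-- one layer per pair holds its countermodel; with N = 1 (OUT₂, OUT₄) OR first splits B
-- until every Aᵢ is decided.  With CT the antecedent is first closed under the triggered
-- pairs (OUT₃) or conjoined with their outputs (OUT₄), so the outputs also hold at layers
-- 1..N.  Unsatisfiable antecedents are covered by the second disjunct of Φ.

open import Defs
open import Data.Bool using (Bool; true; false; not; _∧_; _∨_)
open import Data.Bool.Properties using (∧-conicalˡ; ∧-conicalʳ; ∨-conicalˡ; ∨-conicalʳ; not-injective; not-¬; ¬-not)
open import Data.Empty using (⊥-elim)
open import Data.Fin using (Fin; toℕ) renaming (zero to fzero; suc to fsuc)
open import Data.Fin.Properties using (toℕ<n; any?) renaming (_≟_ to _≟ᶠ_)
open import Data.Fin.Subset using (Subset; _∈_; _-_; ∣_∣; ⊤)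
open import Data.Fin.Subset.Properties using (∈⊤; x∈p∧x≢y⇒x∈p-y; x∈p⇒∣p-x∣<∣p∣)
open import Data.List using (List; []; _∷_; map; tabulate; allFin)
open import Data.List.Membership.Propositional.Properties using (∈-allFin)
import Data.List.Relation.Unary.All as All
open All using (All; []; _∷_)
open import Data.List.Relation.Unary.All.Properties using (map⁺; map⁻; applyUpTo⁺₁; applyUpTo⁻; tabulate⁺; tabulate⁻)
open import Data.Nat using (ℕ; zero; suc; _<_; s≤s; z<s; _⊔_)
open import Data.Nat.Induction using (<-wellFounded)
open import Data.Nat.Properties using (_≟_; ≤-refl; ≤-trans; <-trans; n<1+n; ≤∧≢⇒<; m≤m⊔n; m≤n⊔m)
open import Data.Product using (∃; _×_; _,_; proj₁; proj₂)
open import Data.Sum using (_⊎_; inj₁; inj₂; [_,_]′)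
import Data.Sum as Sum
open import Data.Vec using (Vec; lookup; toList)
import Data.Vec.Relation.Unary.All.Properties as VecAll
open import Function using (_∘_; id; const; case_of_)
open import Function.Bundles using (_⇔_; mk⇔; Equivalence)
open import Function.Construct.Composition using (_⇔-∘_)
open import Function.Related.TypeIsomorphisms using (→-cong-⇔)
open import Induction.WellFounded using (Acc; acc)
open import Relation.Binary.PropositionalEquality using (_≡_; refl; sym; trans; cong; cong₂; subst)
open import Relation.Nullary using (¬_; Dec; yes; no)
open import Relation.Nullary.Decidable using (_×-dec_; ¬?; decidable-stable)

open Equivalence using (to; from)

Valuation : Set
Valuation = ℕ → Bool

not-∧-false⇔ : ∀ {a b} → (not a ∧ b ≡ false) ⇔ (b ≡ true → a ≡ true)
not-∧-false⇔ {true}  = mk⇔ (λ _ _ → refl) (λ _ → refl)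
not-∧-false⇔ {false} {false} = mk⇔ (λ _ ()) (λ _ → refl)
not-∧-false⇔ {false} {true}  = mk⇔ (λ ()) (λ f → sym (f refl))

⇒-true⇔ : ∀ {a b} → (not a ∨ b ≡ true) ⇔ (a ≡ true → b ≡ true)
⇒-true⇔ {true}  = mk⇔ (λ p _ → p) (λ f → f refl)
⇒-true⇔ {false} = mk⇔ (λ _ ()) (λ _ → refl)

⇒-false : ∀ {a b} → not a ∨ b ≡ false → a ≡ true × b ≡ false
⇒-false {true} p = refl , p

∨-true : ∀ {a b} → a ∨ b ≡ true → a ≡ true ⊎ b ≡ true
∨-true {true}  _ = inj₁ refl
∨-true {false} p = inj₂ p

excluded-middle : ∀ c a → c ≡ true → (c ∧ a) ∨ (c ∧ not a) ≡ true
excluded-middle true true  _ = refl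
excluded-middle true false _ = refl

⟦rename⟧ : ∀ {V W : Set} (f : V → W) (A : Formula V) (w : W → Bool) →
           ⟦ rename f A ⟧ w ≡ ⟦ A ⟧ (w ∘ f)
⟦rename⟧ f (var x)  w = refl
⟦rename⟧ f ⊤ᶠ       w = refl
⟦rename⟧ f ⊥ᶠ       w = refl
⟦rename⟧ f (¬ᶠ A)   w = cong not (⟦rename⟧ f A w)
⟦rename⟧ f (A ∧ᶠ B) w = cong₂ _∧_ (⟦rename⟧ f A w) (⟦rename⟧ f B w)
⟦rename⟧ f (A ∨ᶠ B) w = cong₂ _∨_ (⟦rename⟧ f A w) (⟦rename⟧ f B w)
⟦rename⟧ f (A ⇒ᶠ B) w = cong₂ (λ a b → not a ∨ b) (⟦rename⟧ f A w) (⟦rename⟧ f B w)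

rename-true⇔ : ∀ {V W : Set} (f : V → W) (A : Formula V) (w : W → Bool) →
               ⟦ rename f A ⟧ w ≡ true ⇔ ⟦ A ⟧ (w ∘ f) ≡ true
rename-true⇔ f A w = mk⇔ (trans (sym (⟦rename⟧ f A w))) (trans (⟦rename⟧ f A w))

⋀-true⇔ : ∀ {V : Set} (As : List (Formula V)) v →
          ⟦ ⋀ As ⟧ v ≡ true ⇔ All (λ A → ⟦ A ⟧ v ≡ true) As
⋀-true⇔ []       v = mk⇔ (λ _ → []) (λ _ → refl)
⋀-true⇔ (A ∷ As) v = mk⇔
  (λ p → ∧-conicalˡ _ _ p ∷ to (⋀-true⇔ As v) (∧-conicalʳ _ _ p))
  (λ { (p ∷ ps) → cong₂ _∧_ p (from (⋀-true⇔ As v) ps) })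

⋀-toList⇔ : ∀ {A V : Set} {n} (f : A → Formula V) (xs : Vec A n) v →
            ⟦ ⋀ (map f (toList xs)) ⟧ v ≡ true ⇔ (∀ i → ⟦ f (lookup xs i) ⟧ v ≡ true)
⋀-toList⇔ f xs v = mk⇔
  (λ p → VecAll.lookup⁺ (VecAll.toList⁻ (map⁻ (to (⋀-true⇔ (map f (toList xs)) v) p))))
  (λ h → from (⋀-true⇔ (map f (toList xs)) v) (map⁺ (VecAll.toList⁺ (VecAll.lookup⁻ {xs = xs} h))))

layer : (TVar → Bool) → ℕ → Valuation
layer w l x = w (inj₂ (x , l))

⋀-copies⇔ : ∀ X (L : List ℕ) w →
            ⟦ ⋀ (map (λ l → copy l X) L) ⟧ w ≡ true ⇔ All (λ l → ⟦ X ⟧ (layer w l) ≡ true) L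
⋀-copies⇔ X L w = mk⇔
  (λ p → All.map (to (rename-true⇔ _ X w)) (map⁻ (to (⋀-true⇔ _ w) p)))
  (λ ps → from (⋀-true⇔ _ w) (map⁺ (All.map (from (rename-true⇔ _ X w)) ps)))

All-from1⇔ : ∀ {P : ℕ → Set} N → All P (from1 N) ⇔ (∀ {l} → l < N → P (suc l))
All-from1⇔ {P} N = mk⇔ {A = All P (from1 N)} {B = ∀ {l} → l < N → P (suc l)}
  (λ ps → applyUpTo⁻ id N (map⁻ ps))
  (λ ps → map⁺ (applyUpTo⁺₁ id N ps))

All-from0⇔ : ∀ {P : ℕ → Set} N → All P (from0 N) ⇔ (P 0 × (∀ {l} → l < N → P (suc l)))
All-from0⇔ N = mk⇔ (λ { (p ∷ ps) → p , applyUpTo⁻ suc N ps })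
                   (λ (p , ps) → p ∷ applyUpTo⁺₁ suc N (λ {l} l<N → ps l<N))

Holds : ℕ → Set → (TVar → Bool) → IOPair → Set
Holds N Cut w p =
  (∀ {l} → l < N → ⟦ proj₁ p ⟧ (layer w (suc l)) ≡ true) →
  ⟦ proj₂ p ⟧ (layer w 0) ≡ true × (Cut → ∀ {l} → l < N → ⟦ proj₂ p ⟧ (layer w (suc l)) ≡ true)

HoldsT : OutK → ℕ → (TVar → Bool) → IOPair → Set
HoldsT k n = Holds (Nk k n) (HasCT k)

premises⇔ : ∀ A N w → ⟦ ⋀ (map (λ l → copy l A) (from1 N)) ⟧ w ≡ true ⇔
                      (∀ {l} → l < N → ⟦ A ⟧ (layer w (suc l)) ≡ true)
premises⇔ A N w = All-from1⇔ N ⇔-∘ ⋀-copies⇔ A (from1 N) w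

conclusions⇔ : ∀ X N w → ⟦ ⋀ (map (λ l → copy l X) (from0 N)) ⟧ w ≡ true ⇔
                         (⟦ X ⟧ (layer w 0) ≡ true × (∀ {l} → l < N → ⟦ X ⟧ (layer w (suc l)) ≡ true))
conclusions⇔ X N w = All-from0⇔ N ⇔-∘ ⋀-copies⇔ X (from0 N) w

without-CT : ∀ {P Q Cut : Set} → ¬ Cut → P ⇔ (P × (Cut → Q))
without-CT ¬ct = mk⇔ (λ p → p , λ ct → ⊥-elim (¬ct ct)) proj₁

with-CT : ∀ {P Q Cut : Set} → Cut → (P × Q) ⇔ (P × (Cut → Q))
with-CT ct = mk⇔ (λ (p , q) → p , λ _ → q) (λ (p , q) → p , q ct)

T-true⇔HoldsT : ∀ k n w A X → ⟦ T k n (A , X) ⟧ w ≡ true ⇔ HoldsT k n w (A , X)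
T-true⇔HoldsT out₁ n w A X =
  →-cong-⇔ (premises⇔ A _ w) (without-CT (λ ()) ⇔-∘ rename-true⇔ _ X w) ⇔-∘ ⇒-true⇔
T-true⇔HoldsT out₂ n w A X =
  →-cong-⇔ (premises⇔ A _ w) (without-CT (λ ()) ⇔-∘ rename-true⇔ _ X w) ⇔-∘ ⇒-true⇔
T-true⇔HoldsT out₃ n w A X =
  →-cong-⇔ (premises⇔ A _ w) (with-CT ct₃ ⇔-∘ conclusions⇔ X _ w) ⇔-∘ ⇒-true⇔
T-true⇔HoldsT out₄ n w A X =
  →-cong-⇔ (premises⇔ A _ w) (with-CT ct₄ ⇔-∘ conclusions⇔ X _ w) ⇔-∘ ⇒-true⇔

_⊨[_]_ : ∀ {n} → Vec IOPair n → OutK → IOPair → Set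
_⊨[_]_ {n} G k p = ∀ w → (∀ i → HoldsT k n w (lookup G i)) → HoldsT k n w p

OutputsEntail : ∀ {n} → Vec IOPair n → Fm → Set
OutputsEntail G Y = ∀ v → (∀ i → ⟦ proj₂ (lookup G i) ⟧ v ≡ true) → ⟦ Y ⟧ v ≡ true

𝓕-false⇔ : ∀ k {n} (G : Vec IOPair n) B Y w → ⟦ 𝓕 k G (B , Y) ⟧ w ≡ false ⇔
           ((∀ i → HoldsT k n w (lookup G i)) → HoldsT k n w (B , Y))
𝓕-false⇔ k {n} G B Y w = →-cong-⇔ all-T⇔ (T-true⇔HoldsT k n w B Y) ⇔-∘ not-∧-false⇔
  where
  all-T⇔ : ⟦ ⋀ (map (T k n) (toList G)) ⟧ w ≡ true ⇔ (∀ i → HoldsT k n w (lookup G i))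
  all-T⇔ = mk⇔
    (λ p i → to (T-true⇔HoldsT k n w _ _) (to (⋀-toList⇔ (T k n) G w) p i))
    (λ h → from (⋀-toList⇔ (T k n) G w) (λ i → from (T-true⇔HoldsT k n w _ _) (h i)))

outputs-false⇔ : ∀ {n} (G : Vec IOPair n) Y w →
  ⟦ ¬ᶠ orig Y ∧ᶠ ⋀ (map (λ p → orig (proj₂ p)) (toList G)) ⟧ w ≡ false ⇔
  ((∀ i → ⟦ proj₂ (lookup G i) ⟧ (w ∘ inj₁) ≡ true) → ⟦ Y ⟧ (w ∘ inj₁) ≡ true)
outputs-false⇔ G Y w = →-cong-⇔ all-X⇔ (rename-true⇔ inj₁ Y w) ⇔-∘ not-∧-false⇔
  where
  all-X⇔ : ⟦ ⋀ (map (λ p → orig (proj₂ p)) (toList G)) ⟧ w ≡ true ⇔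
           (∀ i → ⟦ proj₂ (lookup G i) ⟧ (w ∘ inj₁) ≡ true)
  all-X⇔ = mk⇔
    (λ p i → to (rename-true⇔ inj₁ (proj₂ (lookup G i)) w) (to (⋀-toList⇔ _ G w) p i))
    (λ h → from (⋀-toList⇔ _ G w) (λ i → from (rename-true⇔ inj₁ (proj₂ (lookup G i)) w) (h i)))

unsat-Φ⇔ : ∀ k {n} (G : Vec IOPair n) B Y →
           Unsat (Φ k G (B , Y)) ⇔ (G ⊨[ k ] (B , Y) × OutputsEntail G Y)
unsat-Φ⇔ k G B Y = mk⇔
  (λ u → (λ w → to (𝓕-false⇔ k G B Y w) (∨-conicalˡ _ _ (u w)))
       , (λ v → to (outputs-false⇔ G Y [ v , const false ]′) (∨-conicalʳ _ _ (u [ v , const false ]′))))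
  (λ (valid , entail) w →
     cong₂ _∨_ (from (𝓕-false⇔ k G B Y w) (valid w)) (from (outputs-false⇔ G Y w) (entail (w ∘ inj₁))))

⊢⇒⊨ : ∀ {k n} {G : Vec IOPair n} {p} → G ⊢[ k ] p → G ⊨[ k ] p
⊢⇒⊨ (leaf i)   w h = h i
⊢⇒⊨ TOP        w h _ = refl , λ _ _ → refl
⊢⇒⊨ (WO d X⊨Y) w h premise with ⊢⇒⊨ d w h premise
... | x₀ , xs = X⊨Y _ x₀ , λ cut l<N → X⊨Y _ (xs cut l<N)
⊢⇒⊨ (SI d B⊨A) w h premise = ⊢⇒⊨ d w h (λ l<N → B⊨A _ (premise l<N))
⊢⇒⊨ (AND d₁ d₂) w h premise with ⊢⇒⊨ d₁ w h premise | ⊢⇒⊨ d₂ w h premise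
... | x₀ , xs | y₀ , ys = cong₂ _∧_ x₀ y₀ , λ cut l<N → cong₂ _∧_ (xs cut l<N) (ys cut l<N)
-- OR is available only when N = 1, so the premise speaks about the single layer 1.
⊢⇒⊨ (OR or₂ d₁ d₂) w h premise with ∨-true (premise z<s)
... | inj₁ a₁ = ⊢⇒⊨ d₁ w h λ { z<s → a₁ }
... | inj₂ a₂ = ⊢⇒⊨ d₂ w h λ { z<s → a₂ }
⊢⇒⊨ (OR or₄ d₁ d₂) w h premise with ∨-true (premise z<s)
... | inj₁ a₁ = ⊢⇒⊨ d₁ w h λ { z<s → a₁ }
... | inj₂ a₂ = ⊢⇒⊨ d₂ w h λ { z<s → a₂ }
⊢⇒⊨ (CT cut d₁ d₂) w h premise =
  ⊢⇒⊨ d₂ w h (λ l<N → cong₂ _∧_ (premise l<N) (proj₂ (⊢⇒⊨ d₁ w h premise) cut l<N))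

⊢⇒OutputsEntail : ∀ {k n} {G : Vec IOPair n} {p} → G ⊢[ k ] p → OutputsEntail G (proj₂ p)
⊢⇒OutputsEntail (leaf i)     v h = h i
⊢⇒OutputsEntail TOP          v h = refl
⊢⇒OutputsEntail (WO d X⊨Y)   v h = X⊨Y v (⊢⇒OutputsEntail d v h)
⊢⇒OutputsEntail (SI d _)     v h = ⊢⇒OutputsEntail d v h
⊢⇒OutputsEntail (AND d₁ d₂)  v h = cong₂ _∧_ (⊢⇒OutputsEntail d₁ v h) (⊢⇒OutputsEntail d₂ v h)
⊢⇒OutputsEntail (OR _ d₁ _)  v h = ⊢⇒OutputsEntail d₁ v h
⊢⇒OutputsEntail (CT _ _ d₂)  v h = ⊢⇒OutputsEntail d₂ v h

Supported : ℕ → (Valuation → Bool) → Set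
Supported m f = ∀ u v → (∀ {x} → x < m → u x ≡ v x) → f u ≡ f v

_[_≔_] : Valuation → ℕ → Bool → Valuation
(v [ m ≔ b ]) x with x ≟ m
... | yes _ = b
... | no  _ = v x

[≔]-supported : ∀ m b f → Supported (suc m) f → Supported m (λ v → f (v [ m ≔ b ]))
[≔]-supported m b f supp u v u≈v = supp _ _ agree
  where
  agree : ∀ {x} → x < suc m → (u [ m ≔ b ]) x ≡ (v [ m ≔ b ]) x
  agree {x} (s≤s x≤m) with x ≟ m
  ... | yes _   = refl
  ... | no  x≢m = u≈v (≤∧≢⇒< x≤m x≢m)

[≔]-self : ∀ v m x → (v [ m ≔ v m ]) x ≡ v x
[≔]-self v m x with x ≟ m
... | yes refl = refl
... | no  _    = refl

valid-or-refutable : ∀ m f → Supported m f → (∀ v → f v ≡ true) ⊎ ∃ λ v → f v ≡ false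
valid-or-refutable zero f supp with f (const false) in eq
... | true  = inj₁ λ v → trans (supp v _ λ ()) eq
... | false = inj₂ (_ , eq)
valid-or-refutable (suc m) f supp
  with valid-or-refutable m (λ v → f (v [ m ≔ true ]))  ([≔]-supported m true f supp)
     | valid-or-refutable m (λ v → f (v [ m ≔ false ])) ([≔]-supported m false f supp)
... | inj₂ (v , fv) | _             = inj₂ (_ , fv)
... | inj₁ _        | inj₂ (v , fv) = inj₂ (_ , fv)
... | inj₁ valid₁   | inj₁ valid₀   =
  inj₁ λ v → trans (supp v _ (λ {x} _ → sym ([≔]-self v m x))) (valid v (v m))
  where
  valid : ∀ v b → f (v [ m ≔ b ]) ≡ true
  valid v true  = valid₁ v
  valid v false = valid₀ v

support : Fm → ℕ
support (var x)  = suc x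
support ⊤ᶠ       = 0
support ⊥ᶠ       = 0
support (¬ᶠ A)   = support A
support (A ∧ᶠ B) = support A ⊔ support B
support (A ∨ᶠ B) = support A ⊔ support B
support (A ⇒ᶠ B) = support A ⊔ support B

supported-⊔ : ∀ {m₁ m₂} (_∙_ : Bool → Bool → Bool) {f g : Valuation → Bool} →
              Supported m₁ f → Supported m₂ g → Supported (m₁ ⊔ m₂) (λ v → f v ∙ g v)
supported-⊔ {m₁} {m₂} _∙_ supp-f supp-g u v u≈v =
  cong₂ _∙_ (supp-f u v (λ x<m₁ → u≈v (≤-trans x<m₁ (m≤m⊔n m₁ m₂))))
            (supp-g u v (λ x<m₂ → u≈v (≤-trans x<m₂ (m≤n⊔m m₁ m₂))))

⟦⟧-supported : ∀ A → Supported (support A) ⟦ A ⟧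
⟦⟧-supported (var x)  u v u≈v = u≈v ≤-refl
⟦⟧-supported ⊤ᶠ       u v u≈v = refl
⟦⟧-supported ⊥ᶠ       u v u≈v = refl
⟦⟧-supported (¬ᶠ A)   u v u≈v = cong not (⟦⟧-supported A u v u≈v)
⟦⟧-supported (A ∧ᶠ B) = supported-⊔ _∧_ (⟦⟧-supported A) (⟦⟧-supported B)
⟦⟧-supported (A ∨ᶠ B) = supported-⊔ _∨_ (⟦⟧-supported A) (⟦⟧-supported B)
⟦⟧-supported (A ⇒ᶠ B) = supported-⊔ (λ a b → not a ∨ b) (⟦⟧-supported A) (⟦⟧-supported B)

data Entailment (C A : Fm) : Set where
  entailed     : C ⊨ A → Entailment C A
  countermodel : ∀ u → ⟦ C ⟧ u ≡ true → ⟦ A ⟧ u ≡ false → Entailment C A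

entails? : ∀ C A → Entailment C A
entails? C A with valid-or-refutable _ ⟦ C ⇒ᶠ A ⟧ (⟦⟧-supported (C ⇒ᶠ A))
... | inj₁ valid    = entailed λ v → to ⇒-true⇔ (valid v)
... | inj₂ (u , fu) = countermodel u (proj₁ (⇒-false fu)) (proj₂ (⇒-false fu))

_⊨?_ : ∀ C A → Dec (C ⊨ A)
C ⊨? A with entails? C A
... | entailed C⊨A         = yes C⊨A
... | countermodel u Cu Au = no λ C⊨A → not-¬ (C⊨A u Cu) Au

satisfiable? : ∀ C → Unsat C ⊎ ∃ λ v → ⟦ C ⟧ v ≡ true
satisfiable? C with entails? C ⊥ᶠ
... | entailed C⊨⊥        = inj₁ λ v → ¬-not λ Cv → case C⊨⊥ v Cv of λ ()
... | countermodel u Cu _ = inj₂ (u , Cu)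

unsat-⊨ : ∀ (C A : Fm) → Unsat C → C ⊨ A
unsat-⊨ C A unsat v Cv = case trans (sym Cv) (unsat v) of λ ()

witness : ∀ {C A} → Entailment C A → Valuation → Valuation
witness (entailed _)         m = m
witness (countermodel u _ _) _ = u

witness-⊨ : ∀ {C A} m → ⟦ C ⟧ m ≡ true → (e : Entailment C A) → ⟦ C ⟧ (witness e m) ≡ true
witness-⊨ m Cm (entailed _)          = Cm
witness-⊨ m Cm (countermodel _ Cu _) = Cu

witness-refutes : ∀ {C A} m (e : Entailment C A) → C ⊨ A ⊎ ⟦ A ⟧ (witness e m) ≡ false
witness-refutes m (entailed C⊨A)        = inj₁ C⊨A
witness-refutes m (countermodel _ _ Au) = inj₂ Au

extend : ∀ {n} → (Fin n → Valuation) → Valuation → ℕ → Valuation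
extend {zero}  ρ m _       = m
extend {suc n} ρ m zero    = ρ fzero
extend {suc n} ρ m (suc l) = extend (ρ ∘ fsuc) m l

extend-toℕ : ∀ {n} (ρ : Fin n → Valuation) m i → extend ρ m (toℕ i) ≡ ρ i
extend-toℕ ρ m fzero    = refl
extend-toℕ ρ m (fsuc i) = extend-toℕ (ρ ∘ fsuc) m i

extend-all : ∀ {n} (P : Valuation → Set) (ρ : Fin n → Valuation) m →
             (∀ i → P (ρ i)) → P m → ∀ l → P (extend ρ m l)
extend-all {zero}  P ρ m Pρ Pm l       = Pm
extend-all {suc n} P ρ m Pρ Pm zero    = Pρ fzero
extend-all {suc n} P ρ m Pρ Pm (suc l) = extend-all P (ρ ∘ fsuc) m (Pρ ∘ fsuc) Pm l

stack : Valuation → (ℕ → Valuation) → TVar → Bool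
stack v c (inj₁ x)           = v x
stack v c (inj₂ (x , zero))  = v x
stack v c (inj₂ (x , suc l)) = c l x

selected : ∀ {P Q : Set} → Fm → P ⊎ Q → Fm
selected X (inj₁ _) = X
selected X (inj₂ _) = ⊤ᶠ

0<Nk : ∀ k n → 0 < Nk k n
0<Nk out₁ n = z<s
0<Nk out₂ n = z<s
0<Nk out₃ n = z<s
0<Nk out₄ n = z<s

module Completeness (k : OutK) {n} (G : Vec IOPair n) (B Y : Fm)
                    (valid : G ⊨[ k ] (B , Y)) (entail : OutputsEntail G Y) where

  N : ℕ
  N = Nk k n

  Aᵢ Xᵢ : Fin n → Fm
  Aᵢ i = proj₁ (lookup G i)
  Xᵢ i = proj₂ (lookup G i)

  ⋀-derivable : ∀ C (Xs : List Fm) → All (λ X → G ⊢[ k ] (C , X)) Xs → G ⊢[ k ] (C , ⋀ Xs)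
  ⋀-derivable C []       []       = SI TOP (λ _ _ → refl)
  ⋀-derivable C (X ∷ Xs) (d ∷ ds) = AND d (⋀-derivable C Xs ds)

  unsat-derivable : ∀ C → Unsat C → G ⊢[ k ] (C , Y)
  unsat-derivable C unsat =
    WO (⋀-derivable C (tabulate Xᵢ) (tabulate⁺ λ i → SI (leaf i) (unsat-⊨ C (Aᵢ i) unsat)))
       (λ v outputs → entail v (tabulate⁻ (to (⋀-true⇔ _ v) outputs)))

  outputsWhere : ∀ {P Q : Fin n → Set} → (∀ i → P i ⊎ Q i) → Fm
  outputsWhere d = ⋀ (tabulate λ i → selected (Xᵢ i) (d i))

  outputsWhere-derivable : ∀ {P Q : Fin n → Set} C (d : ∀ i → P i ⊎ Q i) →
                           (∀ {i} → P i → C ⊨ Aᵢ i) → G ⊢[ k ] (C , outputsWhere d)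
  outputsWhere-derivable C d triggered = ⋀-derivable C _ (tabulate⁺ λ i → derive i (d i))
    where
    derive : ∀ i e → G ⊢[ k ] (C , selected (Xᵢ i) e)
    derive i (inj₁ p) = SI (leaf i) (triggered p)
    derive i (inj₂ _) = SI TOP (λ _ _ → refl)

  outputsWhere-true : ∀ {P Q : Fin n → Set} (d : ∀ i → P i ⊎ Q i) v →
                      ⟦ outputsWhere d ⟧ v ≡ true → ∀ i → ⟦ selected (Xᵢ i) (d i) ⟧ v ≡ true
  outputsWhere-true d v outputs = tabulate⁻ (to (⋀-true⇔ _ v) outputs)

  Active : Fm → Fin n → Set
  Active C i = C ⊨ Aᵢ i × (HasCT k → C ⊨ Xᵢ i)

  RefutedIn : (ℕ → Valuation) → Fin n → Set
  RefutedIn c i = ∃ λ l → l < N × ⟦ Aᵢ i ⟧ (c l) ≡ false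

  derivable-from-copies : ∀ C (c : ℕ → Valuation) → C ⊨ B →
                          (∀ {l} → l < N → ⟦ C ⟧ (c l) ≡ true) →
                          (∀ i → Active C i ⊎ RefutedIn c i) → G ⊢[ k ] (C , Y)
  derivable-from-copies C c C⊨B C-copies d = WO (outputsWhere-derivable C d proj₁) outputs⊨Y
    where
    outputs⊨Y : outputsWhere d ⊨ Y
    outputs⊨Y v outputs =
      proj₁ (valid (stack v c) (λ i → member-holds i (d i) (outputsWhere-true d v outputs i))
                               (λ l<N → C⊨B _ (C-copies l<N)))
      where
      member-holds : ∀ i (e : Active C i ⊎ RefutedIn c i) → ⟦ selected (Xᵢ i) e ⟧ v ≡ true →
                     HoldsT k n (stack v c) (lookup G i)
      member-holds i (inj₁ (_ , closed)) x₀ _ = x₀ , λ cut l<N → closed cut _ (C-copies l<N)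
      member-holds i (inj₂ (l , l<N , refuted)) _ premise = ⊥-elim (not-¬ (premise l<N) refuted)

  Closed : Fm → Set
  Closed C = ∀ i → C ⊨ Aᵢ i → C ⊨ Xᵢ i

  derivable-by-countermodels : n < N → ∀ C → C ⊨ B → (HasCT k → Closed C) → G ⊢[ k ] (C , Y)
  derivable-by-countermodels n<N C C⊨B closed with satisfiable? C
  ... | inj₁ unsat    = unsat-derivable C unsat
  ... | inj₂ (m , Cm) =
    derivable-from-copies C (extend ρ m) C⊨B
      (λ {l} _ → extend-all (λ u → ⟦ C ⟧ u ≡ true) ρ m (λ i → witness-⊨ m Cm (status i)) Cm l)
      (λ i → Sum.map (λ C⊨A → C⊨A , λ cut → closed cut i C⊨A) (refuted i)
                     (witness-refutes m (status i)))
    where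
    status : ∀ i → Entailment C (Aᵢ i)
    status i = entails? C (Aᵢ i)
    ρ : Fin n → Valuation
    ρ i = witness (status i) m
    refuted : ∀ i → ⟦ Aᵢ i ⟧ (ρ i) ≡ false → RefutedIn (extend ρ m) i
    refuted i Af =
      toℕ i , <-trans (toℕ<n i) n<N , subst (λ u → ⟦ Aᵢ i ⟧ u ≡ false) (sym (extend-toℕ ρ m i)) Af

  saturate : HasCT k → (∀ C → C ⊨ B → Closed C → G ⊢[ k ] (C , Y)) →
             ∀ C → C ⊨ B → G ⊢[ k ] (C , Y)
  saturate cut K C C⊨B = go C C⊨B ⊤ (λ _ → inj₁ ∈⊤) (<-wellFounded _)
    where
    -- p contains every j whose output Xⱼ is not yet entailed; each CT step removes one.
    go : ∀ C → C ⊨ B → (p : Subset n) → (∀ j → j ∈ p ⊎ C ⊨ Xᵢ j) → Acc _<_ ∣ p ∣ →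
         G ⊢[ k ] (C , Y)
    go C C⊨B p pending (acc smaller) with any? (λ i → (C ⊨? Aᵢ i) ×-dec ¬? (C ⊨? Xᵢ i))
    ... | no none = K C C⊨B λ i C⊨A → decidable-stable (C ⊨? Xᵢ i) λ C⊭X → none (i , C⊨A , C⊭X)
    ... | yes (i , C⊨A , C⊭X) =
      CT cut (SI (leaf i) C⊨A)
        (go (C ∧ᶠ Xᵢ i) (λ v c → C⊨B v (∧-conicalˡ _ _ c)) (p - i) pending′
            (smaller (x∈p⇒∣p-x∣<∣p∣ i∈p)))
      where
      i∈p : i ∈ p
      i∈p = [ id , ⊥-elim ∘ C⊭X ]′ (pending i)
      pending′ : ∀ j → j ∈ p - i ⊎ (C ∧ᶠ Xᵢ i) ⊨ Xᵢ j
      pending′ j with j ≟ᶠ i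
      ... | yes refl = inj₂ λ v c → ∧-conicalʳ _ _ c
      ... | no  j≢i  = Sum.map (λ j∈p → x∈p∧x≢y⇒x∈p-y j∈p j≢i)
                               (λ C⊨X v c → C⊨X v (∧-conicalˡ _ _ c)) (pending j)

  Decides : Fm → Fin n → Set
  Decides C i = C ⊨ Aᵢ i ⊎ C ⊨ ¬ᶠ Aᵢ i

  split-on : HasOR k → (L : List (Fin n)) → ∀ C →
             (∀ C′ → C′ ⊨ C → All (Decides C′) L → G ⊢[ k ] (C′ , Y)) → G ⊢[ k ] (C , Y)
  split-on or []      C K = K C (λ _ → id) []
  split-on or (i ∷ L) C K =
    SI (OR or (split-on or L (C ∧ᶠ Aᵢ i) (refine (Aᵢ i) λ _ → inj₁))
              (split-on or L (C ∧ᶠ ¬ᶠ Aᵢ i) (refine (¬ᶠ Aᵢ i) λ _ → inj₂)))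
       (λ v Cv → excluded-middle _ _ Cv)
    where
    refine : ∀ D → (∀ C′ → C′ ⊨ D → Decides C′ i) →
             ∀ C′ → C′ ⊨ C ∧ᶠ D → All (Decides C′) L → G ⊢[ k ] (C′ , Y)
    refine D decide C′ C′⊨C∧D ds =
      K C′ (λ v c → ∧-conicalˡ _ _ (C′⊨C∧D v c))
           (decide C′ (λ v c → ∧-conicalʳ _ _ (C′⊨C∧D v c)) ∷ ds)

  split-cases : HasOR k → (∀ C → C ⊨ B → (∀ i → Decides C i) → G ⊢[ k ] (C , Y)) →
                G ⊢[ k ] (B , Y)
  split-cases or K = split-on or (allFin n) B λ C C⊨B ds → K C C⊨B λ i → All.lookup ds (∈-allFin i)

  derivable-when-decided : ∀ C → C ⊨ B → (∀ i → Active C i ⊎ C ⊨ ¬ᶠ Aᵢ i) → G ⊢[ k ] (C , Y)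
  derivable-when-decided C C⊨B d with satisfiable? C
  ... | inj₁ unsat    = unsat-derivable C unsat
  ... | inj₂ (m , Cm) =
    derivable-from-copies C (const m) C⊨B (const Cm)
      (λ i → Sum.map₂ (λ C⊨¬A → 0 , 0<Nk k n , not-injective (C⊨¬A m Cm)) (d i))

  derivable-by-cut-when-decided : HasCT k → ∀ C → C ⊨ B → (∀ i → Decides C i) →
                                  G ⊢[ k ] (C , Y)
  derivable-by-cut-when-decided cut C C⊨B dec =
    CT cut (outputsWhere-derivable C dec id)
      (derivable-when-decided (C ∧ᶠ outputsWhere dec) (λ v c → C⊨B v (∧-conicalˡ _ _ c))
        (λ i → close i (dec i) (λ v c → outputsWhere-true dec v (∧-conicalʳ _ _ c) i)))
    where
    close : ∀ i (e : Decides C i) → (C ∧ᶠ outputsWhere dec) ⊨ selected (Xᵢ i) e →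
            Active (C ∧ᶠ outputsWhere dec) i ⊎ (C ∧ᶠ outputsWhere dec) ⊨ ¬ᶠ Aᵢ i
    close i (inj₁ C⊨A)  X-selected = inj₁ ((λ v c → C⊨A v (∧-conicalˡ _ _ c)) , λ _ → X-selected)
    close i (inj₂ C⊨¬A) _          = inj₂ λ v c → C⊨¬A v (∧-conicalˡ _ _ c)

complete : ∀ k {n} (G : Vec IOPair n) B Y → G ⊨[ k ] (B , Y) → OutputsEntail G Y →
           G ⊢[ k ] (B , Y)
complete out₁ G B Y valid entail = derivable-by-countermodels (n<1+n _) B (λ _ → id) λ ()
  where open Completeness out₁ G B Y valid entail
complete out₂ G B Y valid entail =
  split-cases or₂ λ C C⊨B dec → derivable-when-decided C C⊨B λ i → Sum.map₁ (_, λ ()) (dec i)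
  where open Completeness out₂ G B Y valid entail
complete out₃ G B Y valid entail =
  saturate ct₃ (λ C C⊨B closed → derivable-by-countermodels (n<1+n _) C C⊨B (const closed))
           B (λ _ → id)
  where open Completeness out₃ G B Y valid entail
complete out₄ G B Y valid entail = split-cases or₄ (derivable-by-cut-when-decided ct₄)
  where open Completeness out₄ G B Y valid entail

lemma9 : (k : OutK) (n : ℕ) (G : Vec IOPair n) (B Y : Fm) →
    (G ⊢[ k ] (B , Y)) ⇔ Unsat (Φ k G (B , Y))
lemma9 k n G B Y = mk⇔
  (λ d → from (unsat-Φ⇔ k G B Y) (⊢⇒⊨ d , ⊢⇒OutputsEntail d))
  (λ unsat → let valid , entail = to (unsat-Φ⇔ k G B Y) unsat in complete k G B Y valid entail)
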